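{- Let $k,y,X,H\geqslant1$ be integers. Let $M_k(X,H;y)=\{(x,t_1,\dots,t_k)\in[X]\times[H]^k: y\mid(x+t_1)(x+t_2)\cdots(x+t_k)\}$. Then \[\#M_k(X,H;y)\leqslant O(H)^k\,\tau_k(y)\cdot O(1+X/\operatorname{rad}_k(y)).\]
   Context: $[N]=\{1,\dots,N\}$. $\tau_k(n)$ is the number of tuples $(d_1,\dots,d_k)$ of positive integers with $d_1\cdots d_k=n$. $\operatorname{rad}_k$ is the multiplicative function $\operatorname{rad}_k(n)=\min_{n_1\cdots n_k=n}[n_1,\dots,n_k]$, the minimum over factorizations into $k$ positive integers of their least common multiple. -}

module Defs where

open import Data.Nat using (ℕ; zero; suc; _+_; _*_; _⊓_; _≟_)
open import Data.Nat.Divisibility using (_∣?_)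
open import Data.Nat.LCM using (lcm)
open import Data.List using (List; []; _∷_; map; upTo; length; filter; concatMap; foldr)
open import Data.Vec using (Vec; []; _∷_)
import Data.Vec as Vec

range1 : ℕ → List ℕ
range1 n = map suc (upTo n)

tuples : (k : ℕ) → List ℕ → List (Vec ℕ k)
tuples zero    xs = [] ∷ []
tuples (suc k) xs = concatMap (λ a → map (a ∷_) (tuples k xs)) xs

vprod : ∀ {k} → Vec ℕ k → ℕ
vprod = Vec.foldr′ _*_ 1

vlcm : ∀ {k} → Vec ℕ k → ℕ
vlcm = Vec.foldr′ lcm 1

-- factorizations n = d_1 ⋯ d_k into k positive integers
-- (each d_i divides n, hence lies in [n] when n ≥ 1)
factorizations : (k n : ℕ) → List (Vec ℕ k)
factorizations k n = filter (λ v → vprod v ≟ n) (tuples k (range1 n))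

τ : ℕ → ℕ → ℕ
τ k n = length (factorizations k n)

-- The fold starts at n, which is harmless: for k ≥ 1, n ≥ 1 the factorization
-- (n,1,…,1) has lcm n, and every lcm of a factorization divides n.
rad : ℕ → ℕ → ℕ
rad k n = foldr (λ v m → vlcm v ⊓ m) n (factorizations k n)

countM : (k X H y : ℕ) → ℕ
countM k X H y =
  length (concatMap (λ x → filter (λ t → y ∣? vprod (Vec.map (x +_) t)) (tuples k (range1 H))) (range1 X))

-- If y ∣ (x+t₁)⋯(x+tₖ), splitting y greedily by gcds gives a factorization
-- y = d₁⋯dₖ with dᵢ ∣ x + tᵢ. So for a fixed t the admissible x ∈ [X] are covered
-- by τₖ(y) sets, one for each factorization d, and the points of the set of d are
-- pairwise congruent modulo lcm(d) ≥ radₖ(y); each set therefore has at most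
-- 1 + X / radₖ(y) elements. Summing over the Hᵏ tuples t gives the bound with C = 1.

module Submission where

open import Defs
open import Data.Product using (Σ; ∃-syntax; _×_; _,_)
open import Data.Sum using (_⊎_; inj₁; inj₂)
open import Data.Nat using (ℕ; zero; suc; _+_; _*_; _^_; _≤_; _∸_; _⊓_; _≟_; z≤n; NonZero; ≢-nonZero; ≢-nonZero⁻¹; >-nonZero)
open import Data.Nat.Properties
open import Data.Nat.Divisibility
open import Data.Nat.DivMod using (_/_; m*[n/m]≡n)
open import Data.Nat.GCD using (gcd; gcd[m,n]∣m; gcd[m,n]∣n; gcd[m,n]≢0; gcd-greatest; c*gcd[m,n]≡gcd[cm,cn]; m/gcd[m,n]≢0)
open import Data.Nat.LCM using (lcm-least)
open import Data.List using (List; []; _∷_; [_]; _++_; map; upTo; length; filter; concatMap; foldr)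
open import Data.List.Properties using (length-map; length-++; length-upTo; map-++; upTo-∷ʳ)
open import Data.List.Membership.Propositional using (_∈_; lose)
open import Data.List.Membership.Propositional.Properties using (∈-map⁺; ∈-upTo⁺; ∈-filter⁺; ∈-concatMap⁺)
open import Data.List.Relation.Unary.Any using (here; there)
open import Data.Vec using (Vec; []; _∷_)
import Data.Vec as Vec
open import Data.Vec.Relation.Unary.All using (All; []; _∷_)
import Data.Vec.Relation.Unary.All as All
open import Data.Vec.Relation.Binary.Pointwise.Inductive using (Pointwise; []; _∷_)
import Data.Vec.Relation.Binary.Pointwise.Inductive as Pointwise
open import Relation.Nullary using (Dec; yes; no; contradiction)
open import Relation.Unary using (Pred; Decidable)
open import Relation.Binary.PropositionalEquality hiding ([_])
open import Algebra.Properties.CommutativeSemigroup +-commutativeSemigroup using (interchange; xy∙z≈xz∙y)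
open import Level using (Level)
open import Function using (_∘_)

private
  variable
    a p : Level
    A B : Set a

𝟙 : {P : Set p} → Dec P → ℕ
𝟙 (yes _) = 1
𝟙 (no _)  = 0

𝟙-yes : {P : Set p} (P? : Dec P) → P → 𝟙 P? ≡ 1
𝟙-yes (yes _) _  = refl
𝟙-yes (no ¬P) pr = contradiction pr ¬P

∑ : List A → (A → ℕ) → ℕ
∑ []       f = 0
∑ (x ∷ xs) f = f x + ∑ xs f

infix 5 ∑
syntax ∑ xs (λ x → e) = ∑[ x ∈ xs ] e

∑-cong : {f g : A → ℕ} → (∀ x → f x ≡ g x) → ∀ xs → ∑ xs f ≡ ∑ xs g
∑-cong f≡g []       = refl
∑-cong f≡g (x ∷ xs) = cong₂ _+_ (f≡g x) (∑-cong f≡g xs)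

∑-mono : {f g : A → ℕ} (xs : List A) → (∀ {x} → x ∈ xs → f x ≤ g x) → ∑ xs f ≤ ∑ xs g
∑-mono []       f≤g = z≤n
∑-mono (x ∷ xs) f≤g = +-mono-≤ (f≤g (here refl)) (∑-mono xs (f≤g ∘ there))

∑-const : (c : ℕ) (xs : List A) → ∑[ _ ∈ xs ] c ≡ length xs * c
∑-const c []       = refl
∑-const c (x ∷ xs) = cong (c +_) (∑-const c xs)

∑-*ʳ : (f : A → ℕ) (c : ℕ) (xs : List A) → ∑ xs f * c ≡ ∑[ x ∈ xs ] f x * c
∑-*ʳ f c []       = refl
∑-*ʳ f c (x ∷ xs) = trans (*-distribʳ-+ c (f x) _) (cong (f x * c +_) (∑-*ʳ f c xs))

∑-+ : (f g : A → ℕ) (xs : List A) → ∑[ x ∈ xs ] (f x + g x) ≡ ∑ xs f + ∑ xs g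
∑-+ f g []       = refl
∑-+ f g (x ∷ xs) = trans (cong (f x + g x +_) (∑-+ f g xs)) (interchange (f x) (g x) _ _)

∑-comm : (f : A → B → ℕ) (xs : List A) (ys : List B) →
  ∑[ x ∈ xs ] ∑[ y ∈ ys ] f x y ≡ ∑[ y ∈ ys ] ∑[ x ∈ xs ] f x y
∑-comm f []       ys = sym (trans (∑-const 0 ys) (*-zeroʳ (length ys)))
∑-comm f (x ∷ xs) ys = trans (cong (∑ ys (f x) +_) (∑-comm f xs ys)) (sym (∑-+ (f x) _ ys))

∑-++ : (f : A → ℕ) (xs ys : List A) → ∑ (xs ++ ys) f ≡ ∑ xs f + ∑ ys f
∑-++ f []       ys = refl
∑-++ f (x ∷ xs) ys = trans (cong (f x +_) (∑-++ f xs ys)) (sym (+-assoc (f x) _ _))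

≤-∑ : (f : A → ℕ) {x : A} {xs : List A} → x ∈ xs → f x ≤ ∑ xs f
≤-∑ f (here refl)              = m≤m+n _ _
≤-∑ f {xs = y ∷ _} (there x∈xs) = ≤-trans (≤-∑ f x∈xs) (m≤n+m _ (f y))

length-concatMap : (f : A → List B) (xs : List A) → length (concatMap f xs) ≡ ∑[ x ∈ xs ] length (f x)
length-concatMap f []       = refl
length-concatMap f (x ∷ xs) = trans (length-++ (f x)) (cong (length (f x) +_) (length-concatMap f xs))

length-filter : {P : Pred A p} (P? : Decidable P) (xs : List A) → length (filter P? xs) ≡ ∑[ x ∈ xs ] 𝟙 (P? x)
length-filter P? []       = refl
length-filter P? (x ∷ xs) with P? x
... | yes _ = cong suc (length-filter P? xs)
... | no _  = length-filter P? xs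

length-concatMap-filter : {R : A → B → Set p} (R? : ∀ x y → Dec (R x y)) (xs : List A) (ys : List B) →
  length (concatMap (λ x → filter (R? x) ys) xs) ≡ ∑[ y ∈ ys ] ∑[ x ∈ xs ] 𝟙 (R? x y)
length-concatMap-filter R? xs ys = begin
  length (concatMap (λ x → filter (R? x) ys) xs) ≡⟨ length-concatMap _ xs ⟩
  ∑[ x ∈ xs ] length (filter (R? x) ys)          ≡⟨ ∑-cong (λ x → length-filter (R? x) ys) xs ⟩
  ∑[ x ∈ xs ] ∑[ y ∈ ys ] 𝟙 (R? x y)             ≡⟨ ∑-comm (λ x y → 𝟙 (R? x y)) xs ys ⟩
  ∑[ y ∈ ys ] ∑[ x ∈ xs ] 𝟙 (R? x y)             ∎
  where open ≡-Reasoning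

length-range1 : ∀ n → length (range1 n) ≡ n
length-range1 n = trans (length-map suc (upTo n)) (length-upTo n)

range1-suc : ∀ n → range1 (suc n) ≡ range1 n ++ [ suc n ]
range1-suc n = trans (cong (map suc) (sym (upTo-∷ʳ n))) (map-++ suc (upTo n) [ n ])

∑-range1-suc : (f : ℕ → ℕ) (n : ℕ) → ∑ (range1 (suc n)) f ≡ f (suc n) + ∑ (range1 n) f
∑-range1-suc f n = begin
  ∑ (range1 (suc n)) f             ≡⟨ cong (λ xs → ∑ xs f) (range1-suc n) ⟩
  ∑ (range1 n ++ [ suc n ]) f      ≡⟨ ∑-++ f (range1 n) [ suc n ] ⟩
  ∑ (range1 n) f + (f (suc n) + 0) ≡⟨ cong (∑ (range1 n) f +_) (+-identityʳ (f (suc n))) ⟩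
  ∑ (range1 n) f + f (suc n)       ≡⟨ +-comm (∑ (range1 n) f) (f (suc n)) ⟩
  f (suc n) + ∑ (range1 n) f       ∎
  where open ≡-Reasoning

∣⇒∈-range1 : ∀ {m n} .{{_ : NonZero n}} → m ∣ n → m ∈ range1 n
∣⇒∈-range1 {zero}  {n} 0∣n = contradiction (0∣⇒≡0 0∣n) (≢-nonZero⁻¹ n)
∣⇒∈-range1 {suc m}     m∣n = ∈-map⁺ suc (∈-upTo⁺ (∣⇒≤ m∣n))

length-tuples : ∀ k (xs : List ℕ) → length (tuples k xs) ≡ length xs ^ k
length-tuples zero    xs = refl
length-tuples (suc k) xs = begin
  length (concatMap (λ x → map (x ∷_) (tuples k xs)) xs) ≡⟨ length-concatMap _ xs ⟩
  ∑[ x ∈ xs ] length (map (x ∷_) (tuples k xs))          ≡⟨ ∑-cong (λ x → length-map (x ∷_) (tuples k xs)) xs ⟩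
  ∑[ x ∈ xs ] length (tuples k xs)                       ≡⟨ ∑-const _ xs ⟩
  length xs * length (tuples k xs)                       ≡⟨ cong (length xs *_) (length-tuples k xs) ⟩
  length xs * length xs ^ k                              ∎
  where open ≡-Reasoning

∈-tuples : ∀ {k} {xs : List ℕ} {v : Vec ℕ k} → All (_∈ xs) v → v ∈ tuples k xs
∈-tuples                      []            = here refl
∈-tuples {suc k} {xs} {x ∷ v} (x∈xs ∷ v∈xs) =
  ∈-concatMap⁺ (λ y → map (y ∷_) (tuples k xs)) (lose x∈xs (∈-map⁺ (x ∷_) (∈-tuples v∈xs)))

module _ {P : Pred ℕ p} (P? : Decidable P) where

  countUpTo : ℕ → ℕ
  countUpTo X = ∑[ x ∈ range1 X ] 𝟙 (P? x)

  countUpTo-suc : ∀ X → countUpTo (suc X) ≡ 𝟙 (P? (suc X)) + countUpTo X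
  countUpTo-suc = ∑-range1-suc (𝟙 ∘ P?)

  module _ (L : ℕ) (separated : ∀ {a e} → P a → P (a + suc e) → L ≤ suc e) where

    private
      separated-from : ∀ {a X} → a ≤ X → P a → P (suc X) → L + a ≤ suc X
      separated-from {a} {X} a≤X Pa P1+X = begin
        L + a           ≤⟨ +-monoˡ-≤ a (separated Pa (subst P (sym a+[1+X∸a]≡1+X) P1+X)) ⟩
        suc (X ∸ a) + a ≡⟨ cong suc (m∸n+n≡m a≤X) ⟩
        suc X           ∎
        where
        open ≤-Reasoning
        a+[1+X∸a]≡1+X : a + suc (X ∸ a) ≡ suc X
        a+[1+X∸a]≡1+X = trans (+-suc a (X ∸ a)) (cong suc (m+[n∸m]≡n a≤X))

      -- a is the largest point of P in [X]; the next one lies at least L further.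
      countUpTo-bound : ∀ X → countUpTo X ≡ 0 ⊎ ∃[ a ] (a ≤ X × P a × countUpTo X * L ≤ L + a)
      countUpTo-bound zero = inj₁ refl
      countUpTo-bound (suc X) rewrite countUpTo-suc X with P? (suc X) | countUpTo-bound X
      ... | no _     | inj₁ c≡0                    = inj₁ c≡0
      ... | no _     | inj₂ (a , a≤X , Pa , bound) = inj₂ (a , m≤n⇒m≤1+n a≤X , Pa , bound)
      ... | yes P1+X | inj₁ c≡0                    =
        inj₂ (suc X , ≤-refl , P1+X , +-monoʳ-≤ L (≤-trans (≤-reflexive (cong (_* L) c≡0)) z≤n))
      ... | yes P1+X | inj₂ (a , a≤X , Pa , bound) =
        inj₂ (suc X , ≤-refl , P1+X , +-monoʳ-≤ L (≤-trans bound (separated-from a≤X Pa P1+X)))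

    countUpTo-separated : ∀ X → countUpTo X * L ≤ L + X
    countUpTo-separated X with countUpTo-bound X
    ... | inj₁ c≡0                   = ≤-trans (≤-reflexive (cong (_* L) c≡0)) z≤n
    ... | inj₂ (a , a≤X , _ , bound) = ≤-trans bound (+-monoʳ-≤ L a≤X)

infix 4 _∣*_ _∣*?_

_∣*_ : ∀ {k} → Vec ℕ k → Vec ℕ k → Set
_∣*_ = Pointwise _∣_

_∣*?_ : ∀ {k} (d v : Vec ℕ k) → Dec (d ∣* v)
_∣*?_ = Pointwise.decidable _∣?_

∣vprod⇒∃∣* : ∀ {k} m .{{_ : NonZero m}} (v : Vec ℕ k) → m ∣ vprod v → ∃[ d ] (vprod d ≡ m × d ∣* v)
∣vprod⇒∃∣* m []      m∣1  = [] , sym (∣1⇒≡1 m∣1) , []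
∣vprod⇒∃∣* m (x ∷ v) m∣xv = prepend-gcd (∣vprod⇒∃∣* (m / g) v m/g∣v)
  where
  g = gcd m x
  instance
    g≢0 : NonZero g
    g≢0 = ≢-nonZero (gcd[m,n]≢0 m x (inj₁ (≢-nonZero⁻¹ m)))
    m/g≢0 : NonZero (m / g)
    m/g≢0 = ≢-nonZero (m/gcd[m,n]≢0 m x)
  -- m divides both x · vprod v and m · vprod v, hence their gcd g · vprod v.
  m∣v*g : m ∣ vprod v * g
  m∣v*g = subst (m ∣_) (sym (c*gcd[m,n]≡gcd[cm,cn] (vprod v) m x))
            (gcd-greatest (n∣m*n (vprod v)) (subst (m ∣_) (*-comm x (vprod v)) m∣xv))
  m/g∣v : m / g ∣ vprod v
  m/g∣v = m∣n*o⇒m/n∣o (gcd[m,n]∣m m x) m∣v*g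
  prepend-gcd : ∃[ d ] (vprod d ≡ m / g × d ∣* v) → ∃[ d ] (vprod d ≡ m × d ∣* x ∷ v)
  prepend-gcd (d , d≡m/g , d∣*v) =
    g ∷ d , trans (cong (g *_) d≡m/g) (m*[n/m]≡n (gcd[m,n]∣m m x)) , gcd[m,n]∣n m x ∷ d∣*v

vprod∣⇒All∣ : ∀ {k n} (d : Vec ℕ k) → vprod d ∣ n → All (_∣ n) d
vprod∣⇒All∣ []      _     = []
vprod∣⇒All∣ (x ∷ d) xd∣n = m*n∣⇒m∣ x (vprod d) xd∣n ∷ vprod∣⇒All∣ d (m*n∣⇒n∣ x (vprod d) xd∣n)

∈-factorizations : ∀ {k n} .{{_ : NonZero n}} {d : Vec ℕ k} → vprod d ≡ n → d ∈ factorizations k n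
∈-factorizations {n = n} {d} d≡n = ∈-filter⁺ (λ v → vprod v ≟ n) d∈tuples d≡n
  where
  d∈tuples : d ∈ tuples _ (range1 n)
  d∈tuples = ∈-tuples (All.map ∣⇒∈-range1 (vprod∣⇒All∣ d (∣-reflexive d≡n)))

foldr-⊓-≤ : (f : A → ℕ) (z : ℕ) {x : A} {xs : List A} → x ∈ xs → foldr (λ v m → f v ⊓ m) z xs ≤ f x
foldr-⊓-≤ f z (here refl)              = m⊓n≤m _ _
foldr-⊓-≤ f z {xs = y ∷ _} (there x∈xs) = ≤-trans (m⊓n≤n (f y) _) (foldr-⊓-≤ f z x∈xs)

rad≤vlcm : ∀ {k n} {d : Vec ℕ k} → d ∈ factorizations k n → rad k n ≤ vlcm d
rad≤vlcm {n = n} = foldr-⊓-≤ vlcm n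

vlcm∣shift : ∀ {k} {d t : Vec ℕ k} a e → d ∣* Vec.map (a +_) t → d ∣* Vec.map (a + e +_) t → vlcm d ∣ e
vlcm∣shift {d = []}     {[]}    a e []                []                    = 1∣ e
vlcm∣shift {d = c ∷ d} {x ∷ t} a e (c∣a+x ∷ d∣a+t) (c∣a+e+x ∷ d∣a+e+t) =
  lcm-least (∣m+n∣m⇒∣n (subst (c ∣_) (xy∙z≈xz∙y a e x) c∣a+e+x) c∣a+x) (vlcm∣shift a e d∣a+t d∣a+e+t)

𝟙∣vprod≤∑𝟙∣* : ∀ {k} y .{{_ : NonZero y}} (v : Vec ℕ k) →
  𝟙 (y ∣? vprod v) ≤ ∑[ d ∈ factorizations k y ] 𝟙 (d ∣*? v)
𝟙∣vprod≤∑𝟙∣* y v with y ∣? vprod v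
... | no _    = z≤n
... | yes y∣v with ∣vprod⇒∃∣* y v y∣v
...   | d , d≡y , d∣*v =
  ≤-trans (≤-reflexive (sym (𝟙-yes (d ∣*? v) d∣*v))) (≤-∑ (λ d → 𝟙 (d ∣*? v)) (∈-factorizations d≡y))

countUpTo-∣vprod-shift : ∀ {k} y .{{_ : NonZero y}} X (t : Vec ℕ k) →
  countUpTo (λ x → y ∣? vprod (Vec.map (x +_) t)) X * rad k y ≤ τ k y * (rad k y + X)
countUpTo-∣vprod-shift {k} y X t = begin
  countUpTo (λ x → y ∣? vprod (Vec.map (x +_) t)) X * r     ≤⟨ *-monoˡ-≤ r count≤∑count ⟩
  (∑[ d ∈ F ] countUpTo (λ x → d ∣*? Vec.map (x +_) t) X) * r ≡⟨ ∑-*ʳ _ r F ⟩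
  ∑[ d ∈ F ] countUpTo (λ x → d ∣*? Vec.map (x +_) t) X * r   ≤⟨ ∑-mono F count-d ⟩
  ∑[ _ ∈ F ] (r + X)                                          ≡⟨ ∑-const (r + X) F ⟩
  τ k y * (r + X)                                             ∎
  where
  open ≤-Reasoning
  r = rad k y
  F = factorizations k y
  count≤∑count : countUpTo (λ x → y ∣? vprod (Vec.map (x +_) t)) X ≤
                 ∑[ d ∈ F ] countUpTo (λ x → d ∣*? Vec.map (x +_) t) X
  count≤∑count = ≤-trans (∑-mono (range1 X) (λ {x} _ → 𝟙∣vprod≤∑𝟙∣* y (Vec.map (x +_) t)))
                         (≤-reflexive (∑-comm (λ x d → 𝟙 (d ∣*? Vec.map (x +_) t)) (range1 X) F))
  count-d : ∀ {d} → d ∈ F → countUpTo (λ x → d ∣*? Vec.map (x +_) t) X * r ≤ r + X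
  count-d {d} d∈F = countUpTo-separated _ r separated X
    where
    separated : ∀ {a e} → d ∣* Vec.map (a +_) t → d ∣* Vec.map (a + suc e +_) t → r ≤ suc e
    separated {a} {e} d∣a+t d∣a+1+e+t =
      ≤-trans (rad≤vlcm d∈F) (∣⇒≤ (vlcm∣shift a (suc e) d∣a+t d∣a+1+e+t))

countM-bound : ∀ k y X H .{{_ : NonZero y}} → countM k X H y * rad k y ≤ H ^ k * τ k y * (rad k y + X)
countM-bound k y X H = begin
  countM k X H y * r                                                ≡⟨ cong (_* r) (length-concatMap-filter _ (range1 X) T) ⟩
  (∑[ t ∈ T ] countUpTo (λ x → y ∣? vprod (Vec.map (x +_) t)) X) * r ≡⟨ ∑-*ʳ _ r T ⟩
  ∑[ t ∈ T ] countUpTo (λ x → y ∣? vprod (Vec.map (x +_) t)) X * r   ≤⟨ ∑-mono T (λ {t} _ → countUpTo-∣vprod-shift y X t) ⟩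
  ∑[ _ ∈ T ] τ k y * (r + X)                                         ≡⟨ ∑-const _ T ⟩
  length T * (τ k y * (r + X))                                       ≡⟨ cong (_* (τ k y * (r + X))) length-T ⟩
  H ^ k * (τ k y * (r + X))                                          ≡⟨ *-assoc (H ^ k) (τ k y) _ ⟨
  H ^ k * τ k y * (r + X)                                            ∎
  where
  open ≤-Reasoning
  r = rad k y
  T = tuples k (range1 H)
  length-T : length T ≡ H ^ k
  length-T = trans (length-tuples k (range1 H)) (cong (_^ k) (length-range1 H))

lemma3p1 : Σ ℕ λ C → (k y X H : ℕ) → 1 ≤ k → 1 ≤ y → 1 ≤ X → 1 ≤ H →
    countM k X H y * rad k y ≤ (C * H) ^ k * τ k y * (C * (rad k y + X))
lemma3p1 = 1 , λ k y X H _ 1≤y _ _ →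
  ≤-trans (countM-bound k y X H {{>-nonZero 1≤y}})
          (≤-reflexive (cong₂ (λ h s → h ^ k * τ k y * s) (sym (*-identityˡ H)) (sym (*-identityˡ _))))
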